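{- For all integers $h \ge 2$, we have $(h+1)^2 \in \mathcal{R}_{\mathbf{Z}}(h,4)$, and for all integers $i_0 \in [0,h-2]$ and $r \in [0,1]$, \[ (i_0+1)\left(2(h-i_0) - r\right) + (h-i_0)^2 \in \mathcal{R}_{\mathbf{Z}}(h,4). \]
   Context: For real numbers $u\le v$, $[u,v]$ denotes the integer interval $\{n\in\mathbf{Z}: u\le n\le v\}$. For a nonempty set $A$ of integers and a positive integer $h$, $hA$ denotes the set of all sums of $h$ not necessarily distinct elements of $A$. The sumset size set is $\mathcal{R}_{\mathbf{Z}}(h,k) = \{ |hA| : A \subseteq \mathbf{Z},\ |A| = k \}$. -}

module Defs where

open import Data.Nat using (ℕ; zero; suc)
open import Data.Integer using (ℤ; _+_; 0ℤ)
open import Data.List using (List; length; foldr)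
open import Data.List.Relation.Unary.All using (All)
open import Data.List.Relation.Unary.Unique.Propositional using (Unique)
open import Data.List.Membership.Propositional using (_∈_)
open import Data.Product using (Σ; ∃; _×_)
open import Function.Bundles using (_⇔_)
open import Relation.Binary.PropositionalEquality using (_≡_)

sumℤ : List ℤ → ℤ
sumℤ = foldr _+_ 0ℤ

-- x ∈ hA : x is a sum of h (not necessarily distinct) elements of A
-- (A is represented by a duplicate-free list of its elements)
InSumset : ℕ → List ℤ → ℤ → Set
InSumset h A x = Σ (List ℤ) λ xs → (length xs ≡ h) × (All (_∈ A) xs) × (sumℤ xs ≡ x)

SumsetSize : ℕ → List ℤ → ℕ → Set
SumsetSize h A n = Σ (List ℤ) λ L → Unique L × (length L ≡ n) × (∀ x → (x ∈ L) ⇔ InSumset h A x)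

InR : ℕ → ℕ → ℕ → Set
InR h k n = Σ (List ℤ) λ A → Unique A × (length A ≡ k) × SumsetSize h A n

-- Take A = {0, 1, 2, y}. A sum of h elements of A using y exactly t times is t y + a with
-- 0 ≤ a ≤ 2 (h − t), so hA is the union of the intervals [t y, t y + 2 (h − t)] for t ≤ h.
-- For y = 2h + 1 these h + 1 intervals are pairwise disjoint, giving |hA| = (h + 1)².
-- For y = 2 (h − i₀) − r every interval with t ≤ i₀ reaches the next one (2 (h − t) ≥ y − 1),
-- so those with t ≤ i₀ + 1 form the single interval [0, (i₀ + 1) y + 2 (h − i₀ − 1)],
-- while the remaining h − i₀ − 1 intervals stay disjoint.
module Submission where

open import Defs
open import Data.Nat using (ℕ; zero; suc; _+_; _*_; _∸_; _≤_; _<_; z≤n; s≤s; s≤s⁻¹; _<?_)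
open import Data.Nat.Properties
open import Data.Nat.Tactic.RingSolver using (solve-∀)
open import Algebra.Properties.CommutativeSemigroup +-commutativeSemigroup using (x∙yz≈y∙xz)
open import Data.Integer as ℤ using (ℤ; +_)
import Data.Integer.Properties as ℤ
open import Data.List using (List; []; _∷_; _++_; length; map; upTo)
open import Data.List.Properties using (length-++; length-map; length-upTo)
open import Data.List.Relation.Unary.All using (All; []; _∷_)
open import Data.List.Relation.Unary.Any using (here; there)
open import Data.List.Relation.Unary.AllPairs using ([]; _∷_)
open import Data.List.Relation.Unary.Unique.Propositional using (Unique)
open import Data.List.Relation.Unary.Unique.Propositional.Properties as Unique using (upTo⁺)
open import Data.List.Relation.Binary.Disjoint.Propositional using (Disjoint)
open import Data.List.Membership.Propositional using (_∈_)
open import Data.List.Membership.Propositional.Properties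
  using (∈-map⁺; ∈-map⁻; ∈-++⁺ˡ; ∈-++⁺ʳ; ∈-++⁻; ∈-upTo⁺; ∈-upTo⁻)
open import Data.Product using (_×_; ∃-syntax; _,_)
open import Data.Sum using (_⊎_; inj₁; inj₂)
open import Function.Bundles using (_⇔_; mk⇔; Equivalence)
open import Relation.Binary.PropositionalEquality
open import Relation.Nullary using (¬_; yes; no)

suc-square : ∀ n → suc (2 * n) + n * n ≡ suc n * suc n
suc-square = solve-∀

InSumset-∷ : ∀ {h B x z} → x ∈ B → InSumset h B z → InSumset (suc h) B (x ℤ.+ z)
InSumset-∷ {x = x} x∈B (xs , len , xs⊆B , sum) =
  x ∷ xs , cong suc len , x∈B ∷ xs⊆B , cong (ℤ._+_ x) sum

upTo-disjoint-shift : ∀ {n c} (xs : List ℕ) → n ≤ c → Disjoint (upTo n) (map (_+_ c) xs)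
upTo-disjoint-shift {c = c} xs n≤c (v<n , v∈shift) with ∈-map⁻ (_+_ c) v∈shift
... | u , _ , refl = <-irrefl refl (<-≤-trans (∈-upTo⁻ v<n) (≤-trans n≤c (m≤m+n c u)))

module _ (y : ℕ) where

  A : List ℤ
  A = + 0 ∷ + 1 ∷ + 2 ∷ + y ∷ []

  A-unique : 3 ≤ y → Unique A
  A-unique 3≤y = ((λ ()) ∷ (λ ()) ∷ below 0 (s≤s z≤n) ∷ [])
               ∷ ((λ ()) ∷ below 1 (s≤s (s≤s z≤n)) ∷ [])
               ∷ (below 2 ≤-refl ∷ []) ∷ [] ∷ []
    where
      below : ∀ k → k < 3 → ¬ (+ k ≡ + y)
      below k k<3 eq = <-irrefl (ℤ.+-injective eq) (<-≤-trans k<3 3≤y)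

  -- n ∈ hA, recursively: the sums not using y fill [0, 2h];
  -- the others are y plus an element of (h − 1)A.
  IsSum : ℕ → ℕ → Set
  IsSum zero n = n ≡ 0
  IsSum (suc h) n = n ≤ 2 * suc h ⊎ ∃[ n′ ] n ≡ y + n′ × IsSum h n′

  isSum-≤ : ∀ {h n} → n ≤ 2 * h → IsSum h n
  isSum-≤ {zero} n≤0 = n≤0⇒n≡0 n≤0
  isSum-≤ {suc h} n≤2h = inj₁ n≤2h

  isSum-+digit : ∀ {h d n} → d ≤ 2 → IsSum h n → IsSum (suc h) (d + n)
  isSum-+digit {zero} {d} d≤2 refl = inj₁ (≤-trans (≤-reflexive (+-identityʳ d)) d≤2)
  isSum-+digit {suc h} d≤2 (inj₁ n≤2h) =
    inj₁ (≤-trans (+-mono-≤ d≤2 n≤2h) (≤-reflexive (sym (*-suc 2 (suc h)))))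
  isSum-+digit {suc h} {d} d≤2 (inj₂ (n′ , refl , s)) =
    inj₂ (d + n′ , x∙yz≈y∙xz d y n′ , isSum-+digit d≤2 s)

  isSum-shift : ∀ D {h n} → IsSum h n → IsSum (D + h) (D * y + n)
  isSum-shift zero s = s
  isSum-shift (suc D) {n = n} s = inj₂ (D * y + n , +-assoc y (D * y) n , isSum-shift D s)

  ∈A⇒digit : ∀ {x} → x ∈ A → ∃[ d ] x ≡ + d × (∀ {h n} → IsSum h n → IsSum (suc h) (d + n))
  ∈A⇒digit (here refl) = 0 , refl , isSum-+digit z≤n
  ∈A⇒digit (there (here refl)) = 1 , refl , isSum-+digit (s≤s z≤n)
  ∈A⇒digit (there (there (here refl))) = 2 , refl , isSum-+digit ≤-refl
  ∈A⇒digit (there (there (there (here refl)))) = y , refl , λ {_} {n} s → inj₂ (n , refl , s)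

  isSum-sumℤ : ∀ {xs} → All (_∈ A) xs → ∃[ n ] sumℤ xs ≡ + n × IsSum (length xs) n
  isSum-sumℤ [] = 0 , refl , refl
  isSum-sumℤ (x∈A ∷ xs⊆A) with isSum-sumℤ xs⊆A | ∈A⇒digit x∈A
  ... | n , sum , s | d , refl , step = d + n , cong (ℤ._+_ (+ d)) sum , step s

  inSumset-≤ : ∀ {h n} → n ≤ 2 * h → InSumset h A (+ n)
  inSumset-≤ {zero} n≤0 rewrite n≤0⇒n≡0 n≤0 = [] , refl , [] , refl
  inSumset-≤ {suc h} {zero} _ = InSumset-∷ (here refl) (inSumset-≤ {h} z≤n)
  inSumset-≤ {suc h} {suc zero} _ = InSumset-∷ (there (here refl)) (inSumset-≤ {h} z≤n)
  inSumset-≤ {suc h} {suc (suc n)} n+2≤2h+2 =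
    InSumset-∷ (there (there (here refl)))
      (inSumset-≤ (s≤s⁻¹ (s≤s⁻¹ (≤-trans n+2≤2h+2 (≤-reflexive (*-suc 2 h))))))

  inSumset-isSum : ∀ {h n} → IsSum h n → InSumset h A (+ n)
  inSumset-isSum {zero} refl = [] , refl , [] , refl
  inSumset-isSum {suc h} (inj₁ n≤2h) = inSumset-≤ n≤2h
  inSumset-isSum {suc h} (inj₂ (n′ , refl , s)) =
    InSumset-∷ (there (there (there (here refl)))) (inSumset-isSum s)

  sumsetSize : ∀ {h} (L : List ℕ) → Unique L → (∀ n → n ∈ L ⇔ IsSum h n) →
               SumsetSize h A (length L)
  sumsetSize {h} L L-unique L⇔ =
    map +_ L , Unique.map⁺ ℤ.+-injective L-unique , length-map +_ L , λ x → mk⇔ (to x) (from x)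
    where
      to : ∀ x → x ∈ map +_ L → InSumset h A x
      to x x∈L with ∈-map⁻ +_ x∈L
      ... | n , n∈L , refl = inSumset-isSum (Equivalence.to (L⇔ n) n∈L)
      from : ∀ x → InSumset h A x → x ∈ map +_ L
      from x (xs , refl , xs⊆A , sum) with isSum-sumℤ xs⊆A
      ... | n , sum≡n , s =
        subst (_∈ map +_ L) (trans (sym sum≡n) sum) (∈-map⁺ +_ (Equivalence.from (L⇔ n) s))

  -- ⋃_{t ≤ h} [t y, t y + 2 (h − t)], which lists hA without repetition when y > 2h
  layers : ℕ → List ℕ
  layers zero = 0 ∷ []
  layers (suc h) = upTo (suc (2 * suc h)) ++ map (_+_ y) (layers h)

  ∈-layers⁻ : ∀ h {n} → n ∈ layers h → IsSum h n
  ∈-layers⁻ zero (here refl) = refl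
  ∈-layers⁻ (suc h) n∈ with ∈-++⁻ (upTo (suc (2 * suc h))) n∈
  ... | inj₁ n∈upTo = inj₁ (s≤s⁻¹ (∈-upTo⁻ n∈upTo))
  ... | inj₂ n∈shift with ∈-map⁻ (_+_ y) n∈shift
  ...   | n′ , n′∈ , refl = inj₂ (n′ , refl , ∈-layers⁻ h n′∈)

  ∈-layers⁺ : ∀ h {n} → IsSum h n → n ∈ layers h
  ∈-layers⁺ zero refl = here refl
  ∈-layers⁺ (suc h) (inj₁ n≤2h) = ∈-++⁺ˡ (∈-upTo⁺ (s≤s n≤2h))
  ∈-layers⁺ (suc h) (inj₂ (n′ , refl , s)) = ∈-++⁺ʳ (upTo _) (∈-map⁺ (_+_ y) (∈-layers⁺ h s))

  layers-unique : ∀ h → 2 * h < y → Unique (layers h)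
  layers-unique zero _ = [] ∷ []
  layers-unique (suc h) 2h<y =
    Unique.++⁺ (upTo⁺ _)
      (Unique.map⁺ (+-cancelˡ-≡ y _ _) (layers-unique h (<-trans (*-monoʳ-< 2 (n<1+n h)) 2h<y)))
      (upTo-disjoint-shift (layers h) 2h<y)

  length-layers : ∀ h → length (layers h) ≡ suc h * suc h
  length-layers zero = refl
  length-layers (suc h) = begin
    length (upTo (suc (2 * suc h)) ++ map (_+_ y) (layers h))
      ≡⟨ length-++ (upTo (suc (2 * suc h))) ⟩
    length (upTo (suc (2 * suc h))) + length (map (_+_ y) (layers h))
      ≡⟨ cong₂ _+_ (length-upTo _) (trans (length-map _ (layers h)) (length-layers h)) ⟩
    suc (2 * suc h) + suc h * suc h
      ≡⟨ suc-square (suc h) ⟩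
    suc (suc h) * suc (suc h) ∎
    where open ≡-Reasoning

  InR-listing : ∀ {h} (L : List ℕ) → 3 ≤ y → Unique L → (∀ n → n ∈ L ⇔ IsSum h n) →
                InR h 4 (length L)
  InR-listing L 3≤y L-unique L⇔ = A , A-unique 3≤y , refl , sumsetSize L L-unique L⇔

  InR-separated : ∀ h → 3 ≤ y → 2 * h < y → InR h 4 (suc h * suc h)
  InR-separated h 3≤y 2h<y =
    subst (InR h 4) (length-layers h)
      (InR-listing (layers h) 3≤y (layers-unique h 2h<y) λ _ → mk⇔ (∈-layers⁻ h) (∈-layers⁺ h))

  -- When y ≤ 2h + 3, consecutive layers touch or overlap,
  -- so D more uses of y keep the union an interval.
  isSum-initial : ∀ D {h n} → y ≤ suc (2 * suc h) → n ≤ D * y + 2 * h → IsSum (D + h) n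
  isSum-initial zero y≤ n≤ = isSum-≤ n≤
  isSum-initial (suc D) {h} {n} y≤ n≤ with n <? y
  ... | yes n<y = inj₁ (≤-trans (s≤s⁻¹ (≤-trans n<y y≤)) (*-monoʳ-≤ 2 (s≤s (m≤n+m h D))))
  ... | no n≮y with m≤n⇒∃[o]m+o≡n (≮⇒≥ n≮y)
  ...   | n′ , refl = inj₂ (n′ , refl , isSum-initial D y≤
          (+-cancelˡ-≤ y n′ _ (≤-trans n≤ (≤-reflexive (+-assoc y (D * y) (2 * h))))))

  -- lists (D + m + 1)A when 2m + 2 < y ≤ 2m + 5, the layers t ≤ D being merged into one interval
  mergedLayers : ℕ → ℕ → List ℕ
  mergedLayers D m = upTo (suc (D * y + 2 * suc m)) ++ map (_+_ (suc D * y)) (layers m)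

  ∈-mergedLayers⁻ : ∀ D m {n} → y ≤ suc (2 * suc (suc m)) →
                    n ∈ mergedLayers D m → IsSum (D + suc m) n
  ∈-mergedLayers⁻ D m y≤ n∈ with ∈-++⁻ (upTo (suc (D * y + 2 * suc m))) n∈
  ... | inj₁ n∈upTo = isSum-initial D y≤ (s≤s⁻¹ (∈-upTo⁻ n∈upTo))
  ... | inj₂ n∈shift with ∈-map⁻ (_+_ (suc D * y)) n∈shift
  ...   | l , l∈ , refl =
          subst (λ h → IsSum h (suc D * y + l)) (sym (+-suc D m))
            (isSum-shift (suc D) (∈-layers⁻ m l∈))

  +y-mergedLayers : ∀ D m {n} → n ∈ mergedLayers D m → y + n ∈ mergedLayers (suc D) m
  +y-mergedLayers D m {n} n∈ with ∈-++⁻ (upTo (suc (D * y + 2 * suc m))) n∈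
  ... | inj₁ n∈upTo = ∈-++⁺ˡ (∈-upTo⁺ (begin-strict
    y + n                      <⟨ +-monoʳ-< y (∈-upTo⁻ n∈upTo) ⟩
    y + suc (D * y + 2 * suc m) ≡⟨ +-suc y _ ⟩
    suc (y + (D * y + 2 * suc m)) ≡⟨ cong suc (+-assoc y (D * y) _) ⟨
    suc (suc D * y + 2 * suc m) ∎))
    where open ≤-Reasoning
  ... | inj₂ n∈shift with ∈-map⁻ (_+_ (suc D * y)) n∈shift
  ...   | l , l∈ , refl = ∈-++⁺ʳ (upTo _)
          (subst (_∈ map (_+_ (suc (suc D) * y)) (layers m)) (+-assoc y (suc D * y) l)
            (∈-map⁺ (_+_ (suc (suc D) * y)) l∈))

  ∈-mergedLayers⁺ : ∀ D m {n} → 2 ≤ y → IsSum (D + suc m) n → n ∈ mergedLayers D m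
  ∈-mergedLayers⁺ zero m 2≤y (inj₁ n≤) = ∈-++⁺ˡ (∈-upTo⁺ (s≤s n≤))
  ∈-mergedLayers⁺ zero m 2≤y (inj₂ (n′ , refl , s)) = ∈-++⁺ʳ (upTo _)
    (subst (_∈ map (_+_ (1 * y)) (layers m)) (cong (_+ n′) (*-identityˡ y))
      (∈-map⁺ (_+_ (1 * y)) (∈-layers⁺ m s)))
  ∈-mergedLayers⁺ (suc D) m {n} 2≤y (inj₁ n≤) = ∈-++⁺ˡ (∈-upTo⁺ (s≤s (begin
    n                             ≤⟨ n≤ ⟩
    2 * (suc D + suc m)           ≡⟨ *-distribˡ-+ 2 (suc D) (suc m) ⟩
    2 * suc D + 2 * suc m         ≡⟨ cong (_+ 2 * suc m) (*-comm 2 (suc D)) ⟩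
    suc D * 2 + 2 * suc m         ≤⟨ +-monoˡ-≤ _ (*-monoʳ-≤ (suc D) 2≤y) ⟩
    suc D * y + 2 * suc m         ∎)))
    where open ≤-Reasoning
  ∈-mergedLayers⁺ (suc D) m 2≤y (inj₂ (n′ , refl , s)) =
    +y-mergedLayers D m (∈-mergedLayers⁺ D m 2≤y s)

  mergedLayers-unique : ∀ D m → 2 * suc m < y → Unique (mergedLayers D m)
  mergedLayers-unique D m 2m+2<y =
    Unique.++⁺ (upTo⁺ _)
      (Unique.map⁺ (+-cancelˡ-≡ (suc D * y) _ _)
        (layers-unique m (<-trans (*-monoʳ-< 2 (n<1+n m)) 2m+2<y)))
      (upTo-disjoint-shift (layers m) (begin
        suc (D * y + 2 * suc m) ≡⟨ +-suc (D * y) _ ⟨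
        D * y + suc (2 * suc m) ≤⟨ +-monoʳ-≤ (D * y) 2m+2<y ⟩
        D * y + y               ≡⟨ +-comm (D * y) y ⟩
        suc D * y               ∎))
    where open ≤-Reasoning

  length-mergedLayers : ∀ D m → length (mergedLayers D m) ≡ D * y + suc (suc m) * suc (suc m)
  length-mergedLayers D m = begin
    length (upTo (suc (D * y + 2 * suc m)) ++ map (_+_ (suc D * y)) (layers m))
      ≡⟨ length-++ (upTo (suc (D * y + 2 * suc m))) ⟩
    length (upTo (suc (D * y + 2 * suc m))) + length (map (_+_ (suc D * y)) (layers m))
      ≡⟨ cong₂ _+_ (length-upTo _) (trans (length-map _ (layers m)) (length-layers m)) ⟩
    suc (D * y + 2 * suc m) + suc m * suc m
      ≡⟨ cong (_+ suc m * suc m) (+-suc (D * y) _) ⟨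
    D * y + suc (2 * suc m) + suc m * suc m
      ≡⟨ +-assoc (D * y) _ _ ⟩
    D * y + (suc (2 * suc m) + suc m * suc m)
      ≡⟨ cong (_+_ (D * y)) (suc-square (suc m)) ⟩
    D * y + suc (suc m) * suc (suc m) ∎
    where open ≡-Reasoning

  InR-merged : ∀ D m → 2 * suc m < y → y ≤ suc (2 * suc (suc m)) →
               InR (D + suc m) 4 (D * y + suc (suc m) * suc (suc m))
  InR-merged D m 2m+2<y y≤ =
    subst (InR (D + suc m) 4) (length-mergedLayers D m)
      (InR-listing (mergedLayers D m) 3≤y (mergedLayers-unique D m 2m+2<y)
        λ _ → mk⇔ (∈-mergedLayers⁻ D m y≤) (∈-mergedLayers⁺ D m (≤-trans (n≤1+n 2) 3≤y)))
    where
      3≤y : 3 ≤ y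
      3≤y = ≤-trans (s≤s (*-monoʳ-≤ 2 (s≤s z≤n))) 2m+2<y

InR-square : ∀ h → 1 ≤ h → InR h 4 ((h + 1) * (h + 1))
InR-square h 1≤h =
  subst (λ k → InR h 4 (k * k)) (+-comm 1 h)
    (InR-separated (suc (2 * h)) h (s≤s (*-monoʳ-≤ 2 1≤h)) ≤-refl)

InR-overlapping : ∀ i j r → 2 ≤ j → r ≤ 1 → InR (i + j) 4 ((i + 1) * (2 * j ∸ r) + j * j)
InR-overlapping i (suc (suc m)) r (s≤s (s≤s _)) r≤1 =
  subst₂ (λ h n → InR h 4 n)
    (sym (+-suc i (suc m)))
    (cong (λ k → k * y + suc (suc m) * suc (suc m)) (+-comm 1 i))
    (InR-merged y (suc i) m 2m+2<y y≤2m+5)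
  where
    y : ℕ
    y = 2 * suc (suc m) ∸ r
    2m+2<y : 2 * suc m < y
    2m+2<y = ≤-trans (≤-reflexive (cong (_∸ 1) (sym (*-suc 2 (suc m))))) (∸-monoʳ-≤ _ r≤1)
    y≤2m+5 : y ≤ suc (2 * suc (suc m))
    y≤2m+5 = ≤-trans (m∸n≤m _ r) (n≤1+n _)

mainTheorem8 : (h : ℕ) → 2 ≤ h →
    InR h 4 ((h + 1) * (h + 1))
    × ((i₀ r : ℕ) → i₀ + 2 ≤ h → r ≤ 1 →
        InR h 4 ((i₀ + 1) * (2 * (h ∸ i₀) ∸ r) + (h ∸ i₀) * (h ∸ i₀)))
mainTheorem8 h 2≤h = InR-square h (≤-trans (n≤1+n 1) 2≤h) , overlapping
  where
    overlapping : (i₀ r : ℕ) → i₀ + 2 ≤ h → r ≤ 1 →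
      InR h 4 ((i₀ + 1) * (2 * (h ∸ i₀) ∸ r) + (h ∸ i₀) * (h ∸ i₀))
    overlapping i₀ r i₀+2≤h r≤1 =
      let j = h ∸ i₀ in
      subst (λ h′ → InR h′ 4 ((i₀ + 1) * (2 * j ∸ r) + j * j))
        (m+[n∸m]≡n (≤-trans (m≤m+n i₀ 2) i₀+2≤h))
        (InR-overlapping i₀ j r (m+n≤o⇒m≤o∸n 2 (subst (_≤ h) (+-comm i₀ 2) i₀+2≤h)) r≤1)
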